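{- For every ordering $o$ of $S$, the degeneracy parameter $\kappa$ of $o$ (defined in the context) satisfies $\kappa\ge\theta$.
   Context: $S$ is a finite rooted tree with root $r$. Each non-root $i$ has a unique parent $\mathrm{pa}(i)$, and $\mathrm{child}(i)=\{k:\mathrm{pa}(k)=i\}$. The probabilities satisfy $P(\mathrm{pa}(i),i)>0$ and $\sum_{k\in\mathrm{child}(i)}P(i,k)\le1$. Let $\theta=\min_i\bigl(1-\sum_{k\in\mathrm{child}(i)}P(i,k)\bigr)$. The constants satisfy $\lambda\in(0,1)$ and $\mu\in(0,1]$. Notation: - $\mathrm{anc}(i)$ is the set of states on the path from $r$ to $i$, inclusive. - $\mathrm{sub}(a)=\{i:a\in\mathrm{anc}(i)\}$. - $\pi(r)=1$ and $\pi(i)=\prod_{k\in\mathrm{anc}(i)\setminus\{r\}}P(\mathrm{pa}(k),k)$. - $\mathrm{Top}(X)=\{i\in X:\mathrm{anc}(i)\cap X=\{i\}\}$. - For an ordering $o=(o_1,\dots,o_{|S|})$ of $S$, $o_{[h]}=\{o_1,\dots,o_h\}$. Degeneracy parameter of $o$: - Let $m$ be the largest $m\in\{0,\dots,|S|\}$ with $\lambda\sum_{i\in\mathrm{Top}(o_{[m]})}\pi(i)\le\mu$. - Let $p=o_{m+1}$ if this inequality is strict and $m<|S|$; otherwise $p=\perp$. - If $p\ne\perp$, $\kappa=1-\sum_{i\in\mathrm{Top}(o_{[m]})\cap\mathrm{sub}(p)}\pi(i)/\pi(p)$; if $p=\perp$, $\kappa=+\infty$. -}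

module Defs where

open import Level using (Level; _⊔_; suc)
open import Algebra.Bundles using (CommutativeRing)
open import Relation.Binary.Structures using (IsTotalOrder)
open import Relation.Nullary using (¬_)
open import Relation.Nullary.Decidable using (⌊_⌋)
open import Data.Bool using (Bool; true; false; _∧_; _∨_; not; if_then_else_)
open import Data.Nat as ℕ using (ℕ; zero; _<ᵇ_)
open import Data.Fin using (Fin; toℕ; fromℕ<; _≟_)
open import Data.Fin.Permutation using (Permutation′; _⟨$⟩ʳ_; _⟨$⟩ˡ_)
open import Data.List using (List; []; _∷_; foldr; map; allFin)
open import Data.Bool.ListAction using (any; all)
open import Data.Product using (Σ; _×_; ∃)
open import Relation.Binary.PropositionalEquality using (_≡_; _≢_)

-- Ordered fields (the real numbers are an instance).  Inverse is total,
-- with x * x⁻¹ ≈ 1 required only for x ≉ 0 (convention 0⁻¹ arbitrary).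

record OrderedField (c ℓ₁ ℓ₂ : Level) : Set (Level.suc (c ⊔ ℓ₁ ⊔ ℓ₂)) where
  field
    commutativeRing : CommutativeRing c ℓ₁
  open CommutativeRing commutativeRing public
  field
    _≤_          : Carrier → Carrier → Set ℓ₂
    isTotalOrder : IsTotalOrder _≈_ _≤_
    +-monoˡ-≤    : ∀ {x y} z → x ≤ y → (x + z) ≤ (y + z)
    *-nonneg     : ∀ {x y} → 0# ≤ x → 0# ≤ y → 0# ≤ (x * y)
    _⁻¹          : Carrier → Carrier
    ⁻¹-inverse   : ∀ x → ¬ (x ≈ 0#) → (x * (x ⁻¹)) ≈ 1#
    1≉0          : ¬ (1# ≈ 0#)

  _<_ : Carrier → Carrier → Set (ℓ₁ ⊔ ℓ₂)
  x < y = (x ≤ y) × ¬ (x ≈ y)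

-- Finite rooted trees on the state space Fin n.
-- pa root is irrelevant (never used).  The depth function witnesses that
-- following parents from any state reaches the root (no cycles).

record RootedTree (n : ℕ) : Set where
  field
    root      : Fin n
    pa        : Fin n → Fin n
    depth     : Fin n → ℕ
    depth-root : depth root ≡ 0
    depth-pa  : ∀ i → i ≢ root → depth i ≡ ℕ.suc (depth (pa i))

  _==_ : Fin n → Fin n → Bool
  a == b = ⌊ a ≟ b ⌋

  isRoot : Fin n → Bool
  isRoot i = i == root

  -- path i, pa i, pa (pa i), ..., root  (fuel = number of nodes on the path)
  ancPath : ℕ → Fin n → List (Fin n)
  ancPath zero       i = []
  ancPath (ℕ.suc f)  i = i ∷ (if isRoot i then [] else ancPath f (pa i))

  anc : Fin n → List (Fin n)
  anc i = ancPath (ℕ.suc (depth i)) i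

  _∈anc_ : Fin n → Fin n → Bool
  a ∈anc i = any (a ==_) (anc i)

  isChild : Fin n → Fin n → Bool
  isChild i k = not (isRoot k) ∧ (pa k == i)

  inSub : Fin n → Fin n → Bool
  inSub a i = a ∈anc i

  Top : (Fin n → Bool) → Fin n → Bool
  Top X i = X i ∧ all (λ a → (a == i) ∨ not (X a)) (anc i)

module _ {c ℓ₁ ℓ₂} (F : OrderedField c ℓ₁ ℓ₂) {n : ℕ} (T : RootedTree n) where
  open OrderedField F
  open RootedTree T

  sumWhere : (Fin n → Bool) → (Fin n → Carrier) → Carrier
  sumWhere X f = foldr _+_ 0# (map (λ i → if X i then f i else 0#) (allFin n))

  childSum : (Fin n → Fin n → Carrier) → Fin n → Carrier
  childSum P i = sumWhere (isChild i) (P i)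

  πw : (Fin n → Fin n → Carrier) → Fin n → Carrier
  πw P i = foldr (λ k acc → if isRoot k then acc else (P (pa k) k * acc)) 1# (anc i)

  IsTheta : (Fin n → Fin n → Carrier) → Carrier → Set (ℓ₁ ⊔ ℓ₂)
  IsTheta P θ = (∃ λ i → θ ≈ (1# - childSum P i))
              × (∀ i → θ ≤ (1# - childSum P i))

  -- o_[h] = {o_1,...,o_h}  (o is 0-indexed here: o_[h] = {o j : toℕ j < h})
  prefix : Permutation′ n → ℕ → Fin n → Bool
  prefix o h i = toℕ (o ⟨$⟩ˡ i) <ᵇ h

  topSum : (Fin n → Fin n → Carrier) → Permutation′ n → ℕ → Carrier
  topSum P o h = sumWhere (Top (prefix o h)) (πw P)

  IsLargestM : (Fin n → Fin n → Carrier) → Carrier → Carrier → Permutation′ n → ℕ → Set ℓ₂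
  IsLargestM P lam mu o m =
    (m ℕ.≤ n) × ((lam * topSum P o m) ≤ mu)
    × (∀ m′ → m ℕ.< m′ → m′ ℕ.≤ n → ¬ ((lam * topSum P o m′) ≤ mu))

  kappa : (Fin n → Fin n → Carrier) → Permutation′ n → ℕ → Fin n → Carrier
  kappa P o m p = 1# - sumWhere (λ i → Top (prefix o m) i ∧ inSub p i)
                                (λ i → πw P i * (πw P p ⁻¹))

{-# OPTIONS --safe #-}
-- Read P as a walk that starts at the root and, at j, moves to the child k with probability
-- P j k and stops otherwise. Then π i is the probability of visiting i, stopAt j =
-- (1 - Σ_k P j k) π j ≥ 0 is the probability of stopping at j, and π a is the total stopping
-- probability over sub(a). As p ∉ o_[m], the states of Top(o_[m]) ∩ sub(p) lie strictly below p
-- and none lies below another, so their subtrees are disjoint parts of sub(p) \ {p}. Hence their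
-- π-mass is at most π p - stopAt p = (Σ_k P p k) π p, that is κ ≥ 1 - Σ_k P p k ≥ θ.
module Submission where

open import Defs
open import Data.Bool using (Bool; true; false; T; not; _∧_; _∨_; if_then_else_)
open import Data.Bool.Properties using (T-∧; T-∨; T-not-≡)
open import Data.Empty using (⊥-elim)
open import Data.Fin using (Fin; zero; suc; _≟_; fromℕ<; toℕ)
open import Data.Fin.Properties using (suc-injective; toℕ-fromℕ<)
open import Data.Fin.Permutation using (Permutation′; _⟨$⟩ʳ_; _⟨$⟩ˡ_; inverseˡ)
open import Data.List using (foldr; map; tabulate)
open import Data.List.Relation.Unary.All as All using ()
open import Data.List.Relation.Unary.All.Properties using (all⁺)
open import Data.List.Relation.Unary.Any as Any using ()
open import Data.List.Relation.Unary.Any.Properties using (any⁻)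
import Data.Nat as ℕ
open import Data.Nat using (ℕ; zero; suc)
open import Data.Nat.Induction using (<-wellFounded)
import Data.Nat.Properties as ℕ
open import Data.Product using (_×_; _,_; proj₁; proj₂)
open import Data.Sum using (_⊎_; inj₁; inj₂)
open import Function using (id; _∘_)
open import Function.Bundles using (Equivalence)
import Induction.WellFounded as WF
open import Relation.Binary.Bundles using (Poset)
open import Relation.Binary.Construct.On as On using ()
open import Relation.Binary.Structures using (IsTotalOrder)
import Relation.Binary.Reasoning.PartialOrder as PosetReasoning
open import Relation.Binary.PropositionalEquality as ≡ using (_≡_; _≢_)
open import Relation.Nullary using (¬_; Dec; yes; no; contradiction)
open import Relation.Nullary.Decidable using (⌊_⌋; toWitness; toWitnessFalse; fromWitnessFalse)

module OrderedFieldProperties {c ℓ₁ ℓ₂} (F : OrderedField c ℓ₁ ℓ₂) where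
  open OrderedField F hiding (zero) renaming (_≤_ to infix 4 _≤_; _<_ to infix 4 _<_)
  open IsTotalOrder isTotalOrder public
    using (total; antisym) renaming (refl to ≤-refl; trans to ≤-trans)
  open import Algebra.Properties.Ring ring
    using (-1*x≈-x; -‿distribʳ-*; [y-z]x≈yx-zx; -0#≈0#; -‿involutive; //-rightDividesˡ)

  poset : Poset c ℓ₁ ℓ₂
  poset = record { isPartialOrder = IsTotalOrder.isPartialOrder isTotalOrder }

  open PosetReasoning poset

  +-monoʳ-≤ : ∀ z {x y} → x ≤ y → z + x ≤ z + y
  +-monoʳ-≤ z {x} {y} x≤y = begin
    z + x  ≈⟨ +-comm z x ⟩
    x + z  ≤⟨ +-monoˡ-≤ z x≤y ⟩
    y + z  ≈⟨ +-comm y z ⟩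
    z + y  ∎

  +-mono-≤ : ∀ {x y u v} → x ≤ y → u ≤ v → x + u ≤ y + v
  +-mono-≤ {y = y} {u} x≤y u≤v = ≤-trans (+-monoˡ-≤ u x≤y) (+-monoʳ-≤ y u≤v)

  x≤y⇒0≤y-x : ∀ {x y} → x ≤ y → 0# ≤ y - x
  x≤y⇒0≤y-x {x} {y} x≤y = begin
    0#     ≈⟨ -‿inverseʳ x ⟨
    x - x  ≤⟨ +-monoˡ-≤ (- x) x≤y ⟩
    y - x  ∎

  0≤y-x⇒x≤y : ∀ {x y} → 0# ≤ y - x → x ≤ y
  0≤y-x⇒x≤y {x} {y} 0≤y-x = begin
    x            ≈⟨ +-identityˡ x ⟨
    0# + x       ≤⟨ +-monoˡ-≤ x 0≤y-x ⟩
    (y - x) + x  ≈⟨ //-rightDividesˡ x y ⟩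
    y            ∎

  -‿antimono-≤ : ∀ {x y} → x ≤ y → - y ≤ - x
  -‿antimono-≤ {x} {y} x≤y = 0≤y-x⇒x≤y (begin
    0#        ≤⟨ x≤y⇒0≤y-x x≤y ⟩
    y - x     ≈⟨ +-comm y (- x) ⟩
    - x + y   ≈⟨ +-congˡ (-‿involutive y) ⟨
    - x - - y ∎)

  x≤0⇒0≤-x : ∀ {x} → x ≤ 0# → 0# ≤ - x
  x≤0⇒0≤-x {x} x≤0 = begin
    0#    ≈⟨ -0#≈0# ⟨
    - 0#  ≤⟨ -‿antimono-≤ x≤0 ⟩
    - x   ∎

  *-monoʳ-≤ : ∀ {x y} z → 0# ≤ z → x ≤ y → x * z ≤ y * z
  *-monoʳ-≤ {x} {y} z 0≤z x≤y = 0≤y-x⇒x≤y (begin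
    0#           ≤⟨ *-nonneg (x≤y⇒0≤y-x x≤y) 0≤z ⟩
    (y - x) * z  ≈⟨ [y-z]x≈yx-zx z y x ⟩
    y * z - x * z ∎)

  0≤1 : 0# ≤ 1#
  0≤1 with total 0# 1#
  ... | inj₁ 0≤1 = 0≤1
  ... | inj₂ 1≤0 = contradiction (antisym 1≤0 (begin
    0#          ≤⟨ *-nonneg 0≤-1 0≤-1 ⟩
    - 1# * - 1# ≈⟨ -1*x≈-x (- 1#) ⟩
    - - 1#      ≈⟨ -‿involutive 1# ⟩
    1#          ∎)) 1≉0
    where
    0≤-1 : 0# ≤ - 1#
    0≤-1 = x≤0⇒0≤-x 1≤0

  ¬0≤-1 : ¬ (0# ≤ - 1#)
  ¬0≤-1 0≤-1 = 1≉0 (antisym 1≤0 0≤1)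
    where
    1≤0 : 1# ≤ 0#
    1≤0 = begin
      1#      ≈⟨ -‿involutive 1# ⟨
      - - 1#  ≤⟨ -‿antimono-≤ 0≤-1 ⟩
      - 0#    ≈⟨ -0#≈0# ⟩
      0#      ∎

  ⁻¹-nonneg : ∀ {x} → 0# < x → 0# ≤ x ⁻¹
  ⁻¹-nonneg {x} (0≤x , 0≉x) with total 0# (x ⁻¹)
  ... | inj₁ 0≤x⁻¹ = 0≤x⁻¹
  ... | inj₂ x⁻¹≤0 = contradiction (begin
    0#           ≤⟨ *-nonneg 0≤x (x≤0⇒0≤-x x⁻¹≤0) ⟩
    x * - x ⁻¹   ≈⟨ -‿distribʳ-* x (x ⁻¹) ⟨
    - (x * x ⁻¹) ≈⟨ -‿cong (⁻¹-inverse x (0≉x ∘ sym)) ⟩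
    - 1#         ∎) ¬0≤-1

  *-pos : ∀ {x y} → 0# < x → 0# < y → 0# < x * y
  *-pos {x} {y} (0≤x , 0≉x) (0≤y , 0≉y) = *-nonneg 0≤x 0≤y , λ 0≈xy → 0≉y (begin-equality
    0#             ≈⟨ zeroʳ (x ⁻¹) ⟨
    x ⁻¹ * 0#      ≈⟨ *-congˡ 0≈xy ⟩
    x ⁻¹ * (x * y) ≈⟨ *-assoc (x ⁻¹) x y ⟨
    x ⁻¹ * x * y   ≈⟨ *-congʳ (trans (*-comm (x ⁻¹) x) (⁻¹-inverse x (0≉x ∘ sym))) ⟩
    1# * y         ≈⟨ *-identityˡ y ⟩
    y              ∎)

module IndicatorSums {c ℓ₁ ℓ₂} (F : OrderedField c ℓ₁ ℓ₂) where
  open OrderedField F hiding (zero) renaming (_≤_ to infix 4 _≤_; _<_ to infix 4 _<_)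
  open OrderedFieldProperties F
  open import Algebra.Properties.Ring ring using (-1*x≈-x)
  open import Algebra.Properties.Semiring.Sum semiring public
    using (sum; sum-cong-≋; sum-replicate-zero; ∑-distrib-+; ∑-comm; *-distribˡ-sum; *-distribʳ-sum)
  open PosetReasoning poset

  χ : Bool → Carrier
  χ b = if b then 1# else 0#

  χ-nonneg : ∀ b → 0# ≤ χ b
  χ-nonneg true  = 0≤1
  χ-nonneg false = ≤-refl

  χ-∧ : ∀ b d → χ (b ∧ d) ≈ χ b * χ d
  χ-∧ true  d = sym (*-identityˡ (χ d))
  χ-∧ false d = sym (zeroˡ (χ d))

  χ-∨-disjoint : ∀ b d → (T b → ¬ T d) → χ (b ∨ d) ≈ χ b + χ d
  χ-∨-disjoint true  true  b⇒¬d = contradiction _ (b⇒¬d _)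
  χ-∨-disjoint true  false _    = sym (+-identityʳ 1#)
  χ-∨-disjoint false d     _    = sym (+-identityˡ (χ d))

  T⇒1≈χ : ∀ {b} → T b → 1# ≈ χ b
  T⇒1≈χ {true} _ = refl

  if-else-0≈χ* : ∀ b x → (if b then x else 0#) ≈ χ b * x
  if-else-0≈χ* true  x = sym (*-identityˡ x)
  if-else-0≈χ* false x = sym (zeroˡ x)

  foldr-map-tabulate : ∀ {a} {A : Set a} {k} (h : A → Carrier) (f : Fin k → A) →
                       foldr _+_ 0# (map h (tabulate f)) ≡ sum (h ∘ f)
  foldr-map-tabulate {k = zero}  h f = ≡.refl
  foldr-map-tabulate {k = suc k} h f = ≡.cong (h (f zero) +_) (foldr-map-tabulate h (f ∘ suc))

  sum-zero : ∀ {k} {f : Fin k → Carrier} → (∀ i → f i ≈ 0#) → sum f ≈ 0#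
  sum-zero {k} f≈0 = trans (sum-cong-≋ f≈0) (sum-replicate-zero k)

  sum-mono-≤ : ∀ {k} {f g : Fin k → Carrier} → (∀ i → f i ≤ g i) → sum f ≤ sum g
  sum-mono-≤ {zero}  _   = ≤-refl
  sum-mono-≤ {suc k} f≤g = +-mono-≤ (f≤g zero) (sum-mono-≤ (f≤g ∘ suc))

  ∑-distrib-sub : ∀ {k} (f g : Fin k → Carrier) → sum (λ i → f i - g i) ≈ sum f - sum g
  ∑-distrib-sub f g = begin-equality
    sum (λ i → f i - g i)            ≈⟨ ∑-distrib-+ f (λ i → - g i) ⟩
    sum f + sum (λ i → - g i)        ≈⟨ +-congˡ (sum-cong-≋ (λ i → -1*x≈-x (g i))) ⟨
    sum f + sum (λ i → - 1# * g i)   ≈⟨ +-congˡ (*-distribˡ-sum (- 1#) g) ⟨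
    sum f + - 1# * sum g             ≈⟨ +-congˡ (-1*x≈-x (sum g)) ⟩
    sum f - sum g                    ∎

  sum-single : ∀ {k} {f : Fin k → Carrier} a → (∀ j → j ≢ a → f j ≈ 0#) → sum f ≈ f a
  sum-single {suc k} {f} zero f≈0 = begin-equality
    f zero + sum (f ∘ suc)  ≈⟨ +-congˡ (sum-zero (λ j → f≈0 (suc j) λ ())) ⟩
    f zero + 0#             ≈⟨ +-identityʳ (f zero) ⟩
    f zero                  ∎
  sum-single {suc k} {f} (suc a) f≈0 = begin-equality
    f zero + sum (f ∘ suc)  ≈⟨ +-cong (f≈0 zero λ ()) (sum-single a (λ j j≢a → f≈0 (suc j) (j≢a ∘ suc-injective))) ⟩
    0# + f (suc a)          ≈⟨ +-identityˡ (f (suc a)) ⟩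
    f (suc a)               ∎

  ∑-χ≟ : ∀ {k} (a : Fin k) (h : Fin k → Carrier) → sum (λ j → χ ⌊ a ≟ j ⌋ * h j) ≈ h a
  ∑-χ≟ a h = trans (sum-single a off-a) at-a
    where
    off-a : ∀ j → j ≢ a → χ ⌊ a ≟ j ⌋ * h j ≈ 0#
    off-a j j≢a with a ≟ j
    ... | yes a≡j = contradiction (≡.sym a≡j) j≢a
    ... | no _    = zeroˡ (h j)
    at-a : χ ⌊ a ≟ a ⌋ * h a ≈ h a
    at-a with a ≟ a
    ... | yes _   = *-identityˡ (h a)
    ... | no a≢a  = contradiction ≡.refl a≢a

  ∑-χ-unique≤χ : ∀ {k} (Q : Fin k → Bool) b → (∀ i → T (Q i) → T b) →
                 (∀ i j → T (Q i) → T (Q j) → i ≡ j) → sum (χ ∘ Q) ≤ χ b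
  ∑-χ-unique≤χ {zero}  Q b _ _ = χ-nonneg b
  ∑-χ-unique≤χ {suc k} Q b Q⇒b Q-unique with Q zero | Q⇒b zero | Q-unique zero ∘ suc
  ... | false | _ | _ = begin
    0# + sum (χ ∘ Q ∘ suc)  ≈⟨ +-identityˡ _ ⟩
    sum (χ ∘ Q ∘ suc)       ≤⟨ ∑-χ-unique≤χ (Q ∘ suc) b (Q⇒b ∘ suc) Qₛ-unique ⟩
    χ b                     ∎
    where
    Qₛ-unique : ∀ i j → T (Q (suc i)) → T (Q (suc j)) → i ≡ j
    Qₛ-unique i j Qi Qj = suc-injective (Q-unique (suc i) (suc j) Qi Qj)
  ... | true | Q₀⇒b | Q₀-unique = begin
    1# + sum (χ ∘ Q ∘ suc)  ≈⟨ +-congˡ (sum-zero rest) ⟩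
    1# + 0#                 ≈⟨ +-identityʳ 1# ⟩
    1#                      ≈⟨ T⇒1≈χ (Q₀⇒b _) ⟩
    χ b                     ∎
    where
    rest : ∀ i → χ (Q (suc i)) ≈ 0#
    rest i with Q (suc i) | Q₀-unique i
    ... | false | _     = refl
    ... | true  | Q₀=Qᵢ = contradiction (Q₀=Qᵢ _ _) λ ()

  χ*-congᵀ : ∀ b {x y} → (T b → x ≈ y) → χ b * x ≈ χ b * y
  χ*-congᵀ true  x≈y = *-congˡ (x≈y _)
  χ*-congᵀ false _   = trans (zeroˡ _) (sym (zeroˡ _))

  ∑∑-exchange : ∀ {k l} (u : Fin k → Carrier) (v : Fin k → Fin l → Carrier) (w : Fin l → Carrier) →
                sum (λ i → u i * sum (λ j → v i j * w j)) ≈ sum (λ j → sum (λ i → u i * v i j) * w j)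
  ∑∑-exchange u v w = begin-equality
    sum (λ i → u i * sum (λ j → v i j * w j))  ≈⟨ sum-cong-≋ (λ i → *-distribˡ-sum (u i) (λ j → v i j * w j)) ⟩
    sum (λ i → sum (λ j → u i * (v i j * w j))) ≈⟨ ∑-comm (λ i j → u i * (v i j * w j)) ⟩
    sum (λ j → sum (λ i → u i * (v i j * w j))) ≈⟨ sum-cong-≋ (λ j → sum-cong-≋ (λ i → *-assoc (u i) (v i j) (w j))) ⟨
    sum (λ j → sum (λ i → u i * v i j * w j))   ≈⟨ sum-cong-≋ (λ j → *-distribʳ-sum (w j) (λ i → u i * v i j)) ⟨
    sum (λ j → sum (λ i → u i * v i j) * w j)   ∎

module AncestorProperties {n : ℕ} (tree : RootedTree n) where
  open RootedTree tree

  _≼_ : Fin n → Fin n → Set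
  a ≼ j = T (a ∈anc j)

  _∈strictAnc_ : Fin n → Fin n → Bool
  a ∈strictAnc j = not (isRoot j) ∧ a ∈anc pa j

  _≺_ : Fin n → Fin n → Set
  a ≺ j = T (a ∈strictAnc j)

  ≺⇒≼pa : ∀ {a j} → a ≺ j → j ≢ root × a ≼ pa j
  ≺⇒≼pa a≺j with Equivalence.to T-∧ a≺j
  ... | j≉r , a≼pa = toWitnessFalse j≉r , a≼pa

  ≼pa⇒≺ : ∀ {a j} → j ≢ root → a ≼ pa j → a ≺ j
  ≼pa⇒≺ j≢r a≼pa = Equivalence.from T-∧ (fromWitnessFalse j≢r , a≼pa)

  ∈anc-unfold : ∀ a j → a ∈anc j ≡ (a == j) ∨ (a ∈strictAnc j)
  ∈anc-unfold a j with j ≟ root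
  ... | yes ≡.refl = ≡.refl
  ... | no j≢r rewrite depth-pa j j≢r = ≡.refl

  ≺⇒≼ : ∀ {a j} → a ≺ j → a ≼ j
  ≺⇒≼ {a} {j} a≺j = ≡.subst T (≡.sym (∈anc-unfold a j)) (Equivalence.from (T-∨ {a == j}) (inj₂ a≺j))

  ≼⇒≡⊎≺ : ∀ {a j} → a ≼ j → a ≡ j ⊎ a ≺ j
  ≼⇒≡⊎≺ {a} {j} a≼j with Equivalence.to T-∨ (≡.subst T (∈anc-unfold a j) a≼j)
  ... | inj₁ a≡j = inj₁ (toWitness a≡j)
  ... | inj₂ a≺j = inj₂ a≺j

  depth-pa< : ∀ {j} → j ≢ root → depth (pa j) ℕ.< depth j
  depth-pa< {j} j≢r = ℕ.≤-reflexive (≡.sym (depth-pa j j≢r))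

  ancestor-induction : ∀ {ℓ} (Q : Fin n → Set ℓ) → (∀ j → (j ≢ root → Q (pa j)) → Q j) → ∀ j → Q j
  ancestor-induction Q step = WF.All.wfRec (On.wellFounded depth <-wellFounded) _ Q
    λ j rec → step j (λ j≢r → rec (depth-pa< j≢r))

  ≼⇒depth≤ : ∀ {a j} → a ≼ j → depth a ℕ.≤ depth j
  ≼⇒depth≤ {a} {j} = ancestor-induction (λ j → a ≼ j → depth a ℕ.≤ depth j) step j
    where
    step : ∀ j → (j ≢ root → a ≼ pa j → depth a ℕ.≤ depth (pa j)) → a ≼ j → depth a ℕ.≤ depth j
    step j ih a≼j with ≼⇒≡⊎≺ {a} {j} a≼j
    ... | inj₁ ≡.refl = ℕ.≤-refl
    ... | inj₂ a≺j with ≺⇒≼pa a≺j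
    ...   | j≢r , a≼pa = ℕ.≤-trans (ih j≢r a≼pa) (ℕ.<⇒≤ (depth-pa< j≢r))

  ≺-irrefl : ∀ {a} → ¬ a ≺ a
  ≺-irrefl {a} a≺a with ≺⇒≼pa {a} {a} a≺a
  ... | a≢r , a≼pa = ℕ.<-irrefl ≡.refl (ℕ.≤-<-trans (≼⇒depth≤ {a} {pa a} a≼pa) (depth-pa< a≢r))

  ≼-trans : ∀ {a b c} → a ≼ b → b ≼ c → a ≼ c
  ≼-trans {a} {b} {c} a≼b = ancestor-induction (λ c → b ≼ c → a ≼ c) step c
    where
    step : ∀ c → (c ≢ root → b ≼ pa c → a ≼ pa c) → b ≼ c → a ≼ c
    step c ih b≼c with ≼⇒≡⊎≺ {b} {c} b≼c
    ... | inj₁ ≡.refl = a≼b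
    ... | inj₂ b≺c with ≺⇒≼pa {b} {c} b≺c
    ...   | c≢r , b≼pa = ≺⇒≼ {a} {c} (≼pa⇒≺ c≢r (ih c≢r b≼pa))

  ≼-antisym : ∀ {a b} → a ≼ b → b ≼ a → a ≡ b
  ≼-antisym {a} {b} a≼b b≼a with ≼⇒≡⊎≺ {a} {b} a≼b
  ... | inj₁ a≡b = a≡b
  ... | inj₂ a≺b with ≺⇒≼pa {a} {b} a≺b
  ...   | b≢r , a≼pa = contradiction (≼pa⇒≺ b≢r (≼-trans {b} {a} {pa b} b≼a a≼pa)) (≺-irrefl {b})

  ≼-total-below : ∀ {a b j} → a ≼ j → b ≼ j → a ≼ b ⊎ b ≼ a
  ≼-total-below {a} {b} {j} = ancestor-induction (λ j → a ≼ j → b ≼ j → a ≼ b ⊎ b ≼ a) step j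
    where
    step : ∀ j → (j ≢ root → a ≼ pa j → b ≼ pa j → a ≼ b ⊎ b ≼ a) → a ≼ j → b ≼ j → a ≼ b ⊎ b ≼ a
    step j ih a≼j b≼j with ≼⇒≡⊎≺ {a} {j} a≼j | ≼⇒≡⊎≺ {b} {j} b≼j
    ... | inj₁ ≡.refl | _ = inj₂ b≼j
    ... | inj₂ _ | inj₁ ≡.refl = inj₁ a≼j
    ... | inj₂ a≺j | inj₂ b≺j with ≺⇒≼pa {a} {j} a≺j | ≺⇒≼pa {b} {j} b≺j
    ...   | j≢r , a≼pa | _ , b≼pa = ih j≢r a≼pa b≼pa

  Top⇒∈ : ∀ X {i} → T (Top X i) → T (X i)
  Top⇒∈ X {i} top = proj₁ (Equivalence.to (T-∧ {X i}) top)

  Top-minimal : ∀ X {a i} → T (Top X i) → a ≼ i → T (X a) → a ≡ i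
  Top-minimal X {a} {i} top a≼i a∈X
    with Equivalence.to (T-∨ {a == i}) (All.lookup (all⁺ _ (anc i) (proj₂ (Equivalence.to (T-∧ {X i}) top)))
                                                  (Any.map toWitness (any⁻ _ (anc i) a≼i)))
  ... | inj₁ a≡i = toWitness a≡i
  ... | inj₂ a∉X = ⊥-elim (≡.subst T (Equivalence.to (T-not-≡ {X a}) a∉X) a∈X)

  Top-unique-below : ∀ X {i i′ j} → T (Top X i) → T (Top X i′) → i ≼ j → i′ ≼ j → i ≡ i′
  Top-unique-below X {i} {i′} {j} top top′ i≼j i′≼j with ≼-total-below {i} {i′} {j} i≼j i′≼j
  ... | inj₁ i≼i′ = Top-minimal X top′ i≼i′ (Top⇒∈ X top)
  ... | inj₂ i′≼i = ≡.sym (Top-minimal X top i′≼i (Top⇒∈ X top′))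

  isChild⇒ : ∀ {j k} → T (isChild j k) → k ≢ root × pa k ≡ j
  isChild⇒ {j} {k} child with Equivalence.to (T-∧ {not (isRoot k)}) child
  ... | k≉r , k↦j = toWitnessFalse k≉r , toWitness k↦j

module ReachProbability {c ℓ₁ ℓ₂} (F : OrderedField c ℓ₁ ℓ₂) {n : ℕ} (tree : RootedTree n)
                        (P : Fin n → Fin n → OrderedField.Carrier F) where
  open OrderedField F hiding (zero) renaming (_≤_ to infix 4 _≤_; _<_ to infix 4 _<_)
  open RootedTree tree
  open OrderedFieldProperties F
  open IndicatorSums F
  open AncestorProperties tree
  open import Algebra.Properties.Ring ring
    using (x[y-z]≈xy-xz; [y-z]x≈yx-zx; //-rightDividesˡ; //-rightDividesʳ; +-cancelˡ)
  open PosetReasoning poset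

  π : Fin n → Carrier
  π = πw F tree P

  σ : Fin n → Carrier
  σ = childSum F tree P

  stopAt : Fin n → Carrier
  stopAt j = (1# - σ j) * π j

  sumWhere≈∑χ : ∀ X f → sumWhere F tree X f ≈ sum (λ i → χ (X i) * f i)
  sumWhere≈∑χ X f = trans (reflexive (foldr-map-tabulate (λ i → if X i then f i else 0#) id))
                          (sum-cong-≋ (λ i → if-else-0≈χ* (X i) (f i)))

  π-root : π root ≡ 1#
  π-root with root ≟ root
  ... | yes _   = ≡.refl
  ... | no r≢r = contradiction ≡.refl r≢r

  π-pa : ∀ {j} → j ≢ root → π j ≡ P (pa j) j * π (pa j)
  π-pa {j} j≢r with j ≟ root
  ... | yes j≡r = contradiction j≡r j≢r
  ... | no _ rewrite depth-pa j j≢r = ≡.refl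

  π-pos : (∀ i → i ≢ root → 0# < P (pa i) i) → ∀ j → 0# < π j
  π-pos P>0 = ancestor-induction (λ j → 0# < π j) step
    where
    step : ∀ j → (j ≢ root → 0# < π (pa j)) → 0# < π j
    step j ih = by-cases (j ≟ root)
      where
      by-cases : Dec (j ≡ root) → 0# < π j
      by-cases (yes ≡.refl) = ≡.subst (0# <_) (≡.sym π-root) (0≤1 , 1≉0 ∘ sym)
      by-cases (no j≢r)     = ≡.subst (0# <_) (≡.sym (π-pa j≢r)) (*-pos (P>0 j j≢r) (ih j≢r))

  π-child : ∀ {j k} → T (isChild j k) → π k ≈ P j k * π j
  π-child {j} {k} child with isChild⇒ {j} {k} child
  ... | k≢r , ≡.refl = reflexive (π-pa k≢r)

  ∑-children-π : ∀ j → sum (λ k → χ (isChild j k) * π k) ≈ σ j * π j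
  ∑-children-π j = begin-equality
    sum (λ k → χ (isChild j k) * π k)          ≈⟨ sum-cong-≋ (λ k → χ*-congᵀ (isChild j k) (π-child {j} {k})) ⟩
    sum (λ k → χ (isChild j k) * (P j k * π j)) ≈⟨ sum-cong-≋ (λ k → *-assoc (χ (isChild j k)) (P j k) (π j)) ⟨
    sum (λ k → χ (isChild j k) * P j k * π j)   ≈⟨ *-distribʳ-sum (π j) (λ k → χ (isChild j k) * P j k) ⟨
    sum (λ k → χ (isChild j k) * P j k) * π j   ≈⟨ *-congʳ (sumWhere≈∑χ (isChild j) (P j)) ⟨
    σ j * π j                                   ∎

  χ-∈anc : ∀ a j → χ (a ∈anc j) ≈ χ (a == j) + χ (a ∈strictAnc j)
  χ-∈anc a j = trans (reflexive (≡.cong χ (∈anc-unfold a j))) (χ-∨-disjoint (a == j) (a ∈strictAnc j) a≡j⇒a⊀j)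
    where
    a≡j⇒a⊀j : T (a == j) → ¬ a ≺ j
    a≡j⇒a⊀j a≡j = ≡.subst (λ i → ¬ i ≺ j) (≡.sym (toWitness a≡j)) (≺-irrefl {j})

  ∑-≼-split : ∀ a (h : Fin n → Carrier) →
              sum (λ j → χ (a ∈anc j) * h j) ≈ h a + sum (λ j → χ (a ∈strictAnc j) * h j)
  ∑-≼-split a h = begin-equality
    sum (λ j → χ (a ∈anc j) * h j)
      ≈⟨ sum-cong-≋ (λ j → trans (*-congʳ (χ-∈anc a j)) (distribʳ (h j) (χ (a == j)) (χ (a ∈strictAnc j)))) ⟩
    sum (λ j → χ (a == j) * h j + χ (a ∈strictAnc j) * h j)
      ≈⟨ ∑-distrib-+ (λ j → χ (a == j) * h j) (λ j → χ (a ∈strictAnc j) * h j) ⟩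
    sum (λ j → χ (a == j) * h j) + sum (λ j → χ (a ∈strictAnc j) * h j)
      ≈⟨ +-congʳ (∑-χ≟ a h) ⟩
    h a + sum (λ j → χ (a ∈strictAnc j) * h j) ∎

  ∑-parents : ∀ a k → sum (λ j → χ (a ∈anc j) * χ (isChild j k)) ≈ χ (a ∈strictAnc k)
  ∑-parents a k = begin-equality
    sum (λ j → χ (a ∈anc j) * χ (isChild j k))
      ≈⟨ sum-cong-≋ (λ j → trans (*-congˡ (χ-∧ (not (isRoot k)) (pa k == j))) (rotate (χ (a ∈anc j)) _ _)) ⟩
    sum (λ j → χ (not (isRoot k)) * (χ (pa k == j) * χ (a ∈anc j)))
      ≈⟨ *-distribˡ-sum (χ (not (isRoot k))) (λ j → χ (pa k == j) * χ (a ∈anc j)) ⟨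
    χ (not (isRoot k)) * sum (λ j → χ (pa k == j) * χ (a ∈anc j))
      ≈⟨ *-congˡ (∑-χ≟ (pa k) (λ j → χ (a ∈anc j))) ⟩
    χ (not (isRoot k)) * χ (a ∈anc pa k)
      ≈⟨ χ-∧ (not (isRoot k)) (a ∈anc pa k) ⟨
    χ (a ∈strictAnc k) ∎
    where
    rotate : ∀ x y z → x * (y * z) ≈ y * (z * x)
    rotate x y z = trans (*-comm x (y * z)) (*-assoc y z x)

  stopAt≈ : ∀ j → stopAt j ≈ π j - sum (λ k → χ (isChild j k) * π k)
  stopAt≈ j = begin-equality
    (1# - σ j) * π j      ≈⟨ [y-z]x≈yx-zx (π j) 1# (σ j) ⟩
    1# * π j - σ j * π j  ≈⟨ +-cong (*-identityˡ (π j)) (-‿cong (sym (∑-children-π j))) ⟩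
    π j - sum (λ k → χ (isChild j k) * π k) ∎

  π≈∑-stopAt : ∀ a → sum (λ j → χ (a ∈anc j) * stopAt j) ≈ π a
  π≈∑-stopAt a = begin-equality
    sum (λ j → χ (a ∈anc j) * stopAt j)
      ≈⟨ sum-cong-≋ (λ j → trans (*-congˡ (stopAt≈ j)) (x[y-z]≈xy-xz (χ (a ∈anc j)) (π j) (outflow j))) ⟩
    sum (λ j → χ (a ∈anc j) * π j - χ (a ∈anc j) * outflow j)
      ≈⟨ ∑-distrib-sub (λ j → χ (a ∈anc j) * π j) (λ j → χ (a ∈anc j) * outflow j) ⟩
    sum (λ j → χ (a ∈anc j) * π j) - sum (λ j → χ (a ∈anc j) * outflow j)
      ≈⟨ +-cong (∑-≼-split a π) (-‿cong ∑-outflow) ⟩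
    π a + below - below
      ≈⟨ //-rightDividesʳ below (π a) ⟩
    π a ∎
    where
    outflow : Fin n → Carrier
    outflow j = sum (λ k → χ (isChild j k) * π k)
    below : Carrier
    below = sum (λ k → χ (a ∈strictAnc k) * π k)
    ∑-outflow : sum (λ j → χ (a ∈anc j) * outflow j) ≈ below
    ∑-outflow = trans (∑∑-exchange (λ j → χ (a ∈anc j)) (λ j k → χ (isChild j k)) π)
                      (sum-cong-≋ (λ k → *-congʳ (∑-parents a k)))

  ∑-strict-stopAt : ∀ a → sum (λ j → χ (a ∈strictAnc j) * stopAt j) ≈ σ a * π a
  ∑-strict-stopAt a = +-cancelˡ (stopAt a) _ _ (begin-equality
    stopAt a + sum (λ j → χ (a ∈strictAnc j) * stopAt j) ≈⟨ ∑-≼-split a stopAt ⟨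
    sum (λ j → χ (a ∈anc j) * stopAt j)                  ≈⟨ π≈∑-stopAt a ⟩
    π a                                                  ≈⟨ *-identityˡ (π a) ⟨
    1# * π a                                             ≈⟨ *-congʳ (//-rightDividesˡ (σ a) 1#) ⟨
    (1# - σ a + σ a) * π a                               ≈⟨ distribʳ (π a) (1# - σ a) (σ a) ⟩
    stopAt a + σ a * π a                                 ∎)

  module _ (P>0 : ∀ i → i ≢ root → 0# < P (pa i) i) (σ≤1 : ∀ i → σ i ≤ 1#) where

    stopAt-nonneg : ∀ j → 0# ≤ stopAt j
    stopAt-nonneg j = *-nonneg (x≤y⇒0≤y-x (σ≤1 j)) (proj₁ (π-pos P>0 j))

    module _ (X : Fin n → Bool) {p : Fin n} (p∉X : ¬ T (X p)) where

      topBelow : Fin n → Bool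
      topBelow i = Top X i ∧ inSub p i

      ∑-topBelow≤strict : ∀ j → sum (λ i → χ (topBelow i) * χ (i ∈anc j)) ≤ χ (p ∈strictAnc j)
      ∑-topBelow≤strict j = begin
        sum (λ i → χ (topBelow i) * χ (i ∈anc j)) ≈⟨ sum-cong-≋ (λ i → χ-∧ (topBelow i) (i ∈anc j)) ⟨
        sum (λ i → χ (topBelow i ∧ i ∈anc j))     ≤⟨ ∑-χ-unique≤χ _ (p ∈strictAnc j) below-p below-unique ⟩
        χ (p ∈strictAnc j)                        ∎
        where
        unpack : ∀ {i} → T (topBelow i ∧ i ∈anc j) → T (Top X i) × p ≼ i × i ≼ j
        unpack {i} q with Equivalence.to (T-∧ {topBelow i}) q
        ... | below , i≼j with Equivalence.to (T-∧ {Top X i}) below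
        ...   | top , p≼i = top , p≼i , i≼j
        below-p : ∀ i → T (topBelow i ∧ i ∈anc j) → p ≺ j
        below-p i q with unpack {i} q
        ... | top , p≼i , i≼j with ≼⇒≡⊎≺ {p} {j} (≼-trans {p} {i} {j} p≼i i≼j)
        ...   | inj₂ p≺j = p≺j
        ...   | inj₁ ≡.refl = contradiction (≡.subst (T ∘ X) (≼-antisym {i} {p} i≼j p≼i) (Top⇒∈ X top)) p∉X
        below-unique : ∀ i i′ → T (topBelow i ∧ i ∈anc j) → T (topBelow i′ ∧ i′ ∈anc j) → i ≡ i′
        below-unique i i′ q q′ with unpack {i} q | unpack {i′} q′
        ... | top , _ , i≼j | top′ , _ , i′≼j = Top-unique-below X top top′ i≼j i′≼j

      ∑-topBelow-π≤ : sum (λ i → χ (topBelow i) * π i) ≤ σ p * π p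
      ∑-topBelow-π≤ = begin
        sum (λ i → χ (topBelow i) * π i)
          ≈⟨ sum-cong-≋ (λ i → *-congˡ (π≈∑-stopAt i)) ⟨
        sum (λ i → χ (topBelow i) * sum (λ j → χ (i ∈anc j) * stopAt j))
          ≈⟨ ∑∑-exchange (χ ∘ topBelow) (λ i j → χ (i ∈anc j)) stopAt ⟩
        sum (λ j → sum (λ i → χ (topBelow i) * χ (i ∈anc j)) * stopAt j)
          ≤⟨ sum-mono-≤ (λ j → *-monoʳ-≤ (stopAt j) (stopAt-nonneg j) (∑-topBelow≤strict j)) ⟩
        sum (λ j → χ (p ∈strictAnc j) * stopAt j)
          ≈⟨ ∑-strict-stopAt p ⟩
        σ p * π p ∎

      topBelowShare≤σ : sumWhere F tree topBelow (λ i → π i * π p ⁻¹) ≤ σ p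
      topBelowShare≤σ = begin
        sumWhere F tree topBelow (λ i → π i * π p ⁻¹) ≈⟨ sumWhere≈∑χ topBelow (λ i → π i * π p ⁻¹) ⟩
        sum (λ i → χ (topBelow i) * (π i * π p ⁻¹))   ≈⟨ sum-cong-≋ (λ i → *-assoc (χ (topBelow i)) (π i) (π p ⁻¹)) ⟨
        sum (λ i → χ (topBelow i) * π i * π p ⁻¹)     ≈⟨ *-distribʳ-sum (π p ⁻¹) (λ i → χ (topBelow i) * π i) ⟨
        sum (λ i → χ (topBelow i) * π i) * π p ⁻¹     ≤⟨ *-monoʳ-≤ (π p ⁻¹) (⁻¹-nonneg (π-pos P>0 p)) ∑-topBelow-π≤ ⟩
        σ p * π p * π p ⁻¹                            ≈⟨ *-assoc (σ p) (π p) (π p ⁻¹) ⟩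
        σ p * (π p * π p ⁻¹)                          ≈⟨ *-congˡ (⁻¹-inverse (π p) (proj₂ (π-pos P>0 p) ∘ sym)) ⟩
        σ p * 1#                                      ≈⟨ *-identityʳ (σ p) ⟩
        σ p                                           ∎

next∉prefix : ∀ {c ℓ₁ ℓ₂} (F : OrderedField c ℓ₁ ℓ₂) {n} (tree : RootedTree n)
              (o : Permutation′ n) {m} (m<n : m ℕ.< n) → ¬ T (prefix F tree o m (o ⟨$⟩ʳ fromℕ< m<n))
next∉prefix F tree o {m} m<n m<m = ℕ.<-irrefl ≡.refl (ℕ.<ᵇ⇒< m m (≡.subst (λ k → T (k ℕ.<ᵇ m)) position m<m))
  where
  position : toℕ (o ⟨$⟩ˡ (o ⟨$⟩ʳ fromℕ< m<n)) ≡ m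
  position = ≡.trans (≡.cong toℕ (inverseˡ o)) (toℕ-fromℕ< m<n)

lemma19 : ∀ {c ℓ₁ ℓ₂} (F : OrderedField c ℓ₁ ℓ₂) {n : ℕ} (T : RootedTree n) →
    let open OrderedField F
        open RootedTree T
    in (P : Fin n → Fin n → Carrier) (lam mu θ : Carrier) →
       (∀ i → i ≢ root → 0# < P (pa i) i) →
       (∀ i → childSum F T P i ≤ 1#) →
       (0# < lam) → (lam < 1#) → (0# < mu) → (mu ≤ 1#) →
       IsTheta F T P θ →
       (o : Permutation′ n) (m : ℕ) → IsLargestM F T P lam mu o m →
       ((lam * topSum F T P o m) < mu) →
       (m<n : m ℕ.< n) →
       θ ≤ kappa F T P o m (o ⟨$⟩ʳ fromℕ< m<n)
lemma19 F {n} tree P _ _ θ P>0 σ≤1 _ _ _ _ (_ , θ≤1-σ) o m _ _ m<n = begin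
  θ                     ≤⟨ θ≤1-σ p ⟩
  1# - σ p              ≤⟨ +-monoʳ-≤ 1# (-‿antimono-≤ (topBelowShare≤σ P>0 σ≤1 (prefix F tree o m) p∉o[m])) ⟩
  kappa F tree P o m p  ∎
  where
  open OrderedField F
  open OrderedFieldProperties F
  open ReachProbability F tree P
  open PosetReasoning poset
  p : Fin n
  p = o ⟨$⟩ʳ fromℕ< m<n
  p∉o[m] : ¬ T (prefix F tree o m p)
  p∉o[m] = next∉prefix F tree o m<n
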